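{- Let $1\le m\le n$ be integers. Let $\mathcal{N}_m(n)$ be the set of pairs $(v,F)$ where $F$ is a rooted forest on $[n]$ with exactly $m$ trees in which every vertex is a record, and $v$ is a non-root vertex of $F$. Let $\mathcal{R}_m(n,n-1)$ be the set of rooted forests on $[n]$ with exactly $m$ trees and exactly $n-1$ records. Then there exists a bijection $\mathcal{N}_m(n)\to\mathcal{R}_m(n,n-1)$.
   Context: A rooted forest on $[n]=\{1,\dots,n\}$ is a set of labeled rooted trees whose vertex sets partition $[n]$. A vertex is a record if its label is the largest on the path from it to the root of its tree (inclusive). Forests in which every vertex is a record are the increasing forests (labels increase along every path away from a root). -}

module Defs where

open import Data.Nat using (ℕ; zero; suc; _≤ᵇ_; _≡ᵇ_)
open import Data.Bool using (Bool; true; false; _∧_; T; not)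
open import Data.Bool.Properties using (T?)
open import Data.Fin using (Fin; toℕ)
open import Data.Maybe using (Maybe; just; nothing; is-nothing; is-just)
open import Data.Vec using (Vec; lookup; allFin; count; toList)
open import Data.List using (List)
import Data.List as L
open import Data.Product using (Σ; _×_; _,_)
open import Relation.Nullary.Decidable using (does)

-- Labels [n] = {1,…,n} are represented by Fin n = {0,…,n-1} (order-preserving shift).
-- A rooted forest on [n] is given by its parent map: entry v is `nothing`
-- if v is a root, and `just u` if u is the parent of v.

countB : {n : ℕ} → (Fin n → Bool) → ℕ
countB {n} f = L.length (L.filter (λ v → T? (f v)) (toList (allFin n)))

allB : {n : ℕ} → (Fin n → Bool) → Bool
allB {n} f = L.foldr (λ v b → f v ∧ b) true (toList (allFin n))

ParentMap : ℕ → Set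
ParentMap n = Vec (Maybe (Fin n)) n

module _ {n : ℕ} (p : ParentMap n) where

  par : Fin n → Maybe (Fin n)
  par v = lookup p v

  reach : ℕ → Maybe (Fin n) → Bool
  reach k       nothing  = true
  reach zero    (just _) = false
  reach (suc k) (just u) = reach k (par u)

  -- p is a rooted forest: from every vertex the chain of ancestors terminates
  -- (a vertex has at most n-1 proper ancestors, so n steps suffice).
  isForest : Bool
  isForest = allB (λ v → reach n (par v))

  ancestorsBelow : ℕ → Maybe (Fin n) → Fin n → Bool
  ancestorsBelow k       nothing  v = true
  ancestorsBelow zero    (just _) v = false
  ancestorsBelow (suc k) (just u) v = (toℕ u ≤ᵇ toℕ v) ∧ ancestorsBelow k (par u) v

  isRecord : Fin n → Bool
  isRecord v = ancestorsBelow n (par v) v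

  isRoot : Fin n → Bool
  isRoot v = is-nothing (par v)

  numTrees : ℕ
  numTrees = countB isRoot

  numRecords : ℕ
  numRecords = countB isRecord

  allRecords : Bool
  allRecords = allB isRecord

𝒩 : ℕ → ℕ → Set
𝒩 m n = Σ (ParentMap n) λ p →
          T (isForest p ∧ allRecords p ∧ (numTrees p ≡ᵇ m))
          × Σ (Fin n) λ v → T (not (isRoot p v))

ℛ : ℕ → ℕ → Set
ℛ m n = Σ (ParentMap n) λ p →
          T (isForest p ∧ (numTrees p ≡ᵇ m) ∧ (numRecords p ≡ᵇ Data.Nat.pred n))
  where import Data.Nat

{-# OPTIONS --safe #-}
module Submission where

-- Both sides satisfy the same recurrence, found by removing the largest vertex n.
-- In an increasing forest n is a leaf. If an old vertex is marked, deleting n leaves a marked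
-- increasing forest on [n-1], with m trees and a parent for n (n-1 choices) if n had one, or
-- with m-1 trees if n was a root. If n itself is marked, it is not a root, and what remains is
-- an increasing forest on [n-1] with m trees together with the parent of n.
-- In a forest with n-1 records, n is a record. If n is a leaf, deleting it again leaves a
-- forest of the same kind on [n-1], with a parent for n or with one tree fewer. Otherwise every
-- child of n is a non-record, so n has exactly one child w, and w is a leaf since a child of w
-- would be a second non-record; deleting w leaves an increasing forest on [n-1] with m trees,
-- and w had one of n-1 positions.
-- Both sides are empty for n = 1.

open import Algebra.Bundles using (CommutativeMonoid)
open import Data.Bool using (Bool; true; false; _∧_; not; T)
open import Data.Bool.Properties
  using (T?; T-≡; T-∧; T-irrelevant; ⇔→≡; ∧-conicalˡ; ∧-conicalʳ; ∧-zeroʳ; ∧-identityʳ; ∧-comm;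
         ∧-commutativeMonoid)
open import Data.Empty using (⊥; ⊥-elim)
open import Data.Fin using (Fin; zero; suc; toℕ; fromℕ; inject₁; pinch; punchIn; punchOut; _≟_)
import Data.Fin.Properties as Fin
open import Data.List using (filter; length; foldr)
open import Data.Maybe using (Maybe; just; nothing; fromMaybe; maybe′; _>>=_; is-nothing)
import Data.Maybe as Maybe
import Data.Maybe.Properties as Maybe
open import Data.Nat
  using (ℕ; zero; suc; pred; _+_; _*_; _∸_; _≤_; _<_; z≤n; s≤s; _≡ᵇ_; _≤ᵇ_; >-nonZero)
import Data.Nat.Properties as ℕ
open import Data.Product using (Σ; ∃; _×_; _,_; proj₁; proj₂)
open import Data.Product.Function.NonDependent.Propositional using (_×-↔_)
open import Data.Sum using (_⊎_; inj₁; inj₂)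
open import Data.Sum.Function.Propositional using (_⊎-↔_)
open import Data.Vec using (Vec; []; _∷_; lookup; tabulate; toList)
open import Data.Vec.Properties using (lookup∘tabulate; tabulate∘lookup; tabulate-cong)
open import Function using (_∘_; case_of_; mk⇔; Equivalence)
open import Function.Bundles using (_↔_; _⤖_; mk↔ₛ′)
open import Function.Properties.Inverse using (↔-refl; ↔-sym; ↔-trans; ↔⇒⤖)
open import Function.Related.TypeIsomorphisms using (Σ-distribʳ-⊎)
open import Relation.Binary.PropositionalEquality
open import Relation.Nullary using (Dec; yes; no; ¬_)
open import Relation.Nullary.Decidable using (dec-true; dec-false; does-⇔)
open import Defs

open import Algebra.Properties.CommutativeSemigroup ℕ.+-commutativeSemigroup
  using () renaming (x∙yz≈y∙xz to +-left-comm)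
open import Algebra.Properties.CommutativeSemigroup
  (CommutativeMonoid.commutativeSemigroup ∧-commutativeMonoid)
  using () renaming (x∙yz≈y∙xz to ∧-left-comm)

private variable
  n k : ℕ

indicator : Bool → ℕ
indicator true  = 1
indicator false = 0

count : (Fin n → Bool) → ℕ
count {zero}  f = 0
count {suc n} f = indicator (f zero) + count (f ∘ suc)

all : (Fin n → Bool) → Bool
all {zero}  f = true
all {suc n} f = f zero ∧ all (f ∘ suc)

countB-tabulate : (f : Fin n → Bool) (g : Fin k → Fin n) →
                  length (filter (T? ∘ f) (toList (tabulate g))) ≡ count (f ∘ g)
countB-tabulate {k = zero}  f g = refl
countB-tabulate {k = suc k} f g with f (g zero)
... | true  = cong suc (countB-tabulate f (g ∘ suc))
... | false = countB-tabulate f (g ∘ suc)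

countB≡count : (f : Fin n → Bool) → countB f ≡ count f
countB≡count f = countB-tabulate f (λ i → i)

allB-tabulate : (f : Fin n → Bool) (g : Fin k → Fin n) →
                foldr (λ v b → f v ∧ b) true (toList (tabulate g)) ≡ all (f ∘ g)
allB-tabulate {k = zero}  f g = refl
allB-tabulate {k = suc k} f g = cong (f (g zero) ∧_) (allB-tabulate f (g ∘ suc))

allB≡all : (f : Fin n → Bool) → allB f ≡ all f
allB≡all f = allB-tabulate f (λ i → i)

count-cong : {f g : Fin n → Bool} → (∀ i → f i ≡ g i) → count f ≡ count g
count-cong {zero}  f≗g = refl
count-cong {suc n} f≗g = cong₂ _+_ (cong indicator (f≗g zero)) (count-cong (f≗g ∘ suc))

all-cong : {f g : Fin n → Bool} → (∀ i → f i ≡ g i) → all f ≡ all g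
all-cong {zero}  f≗g = refl
all-cong {suc n} f≗g = cong₂ _∧_ (f≗g zero) (all-cong (f≗g ∘ suc))

count≤n : (f : Fin n → Bool) → count f ≤ n
count≤n {zero}  f = z≤n
count≤n {suc n} f with f zero
... | true  = s≤s (count≤n (f ∘ suc))
... | false = ℕ.m≤n⇒m≤1+n (count≤n (f ∘ suc))

count-punchIn : (w : Fin (suc n)) (f : Fin (suc n) → Bool) →
                count f ≡ indicator (f w) + count (f ∘ punchIn w)
count-punchIn zero    f = refl
count-punchIn {suc n} (suc w) f
  = trans (cong (indicator (f zero) +_) (count-punchIn w (f ∘ suc)))
          (+-left-comm (indicator (f zero)) (indicator (f (suc w))) _)

all-punchIn : (w : Fin (suc n)) (f : Fin (suc n) → Bool) →
              all f ≡ f w ∧ all (f ∘ punchIn w)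
all-punchIn zero    f = refl
all-punchIn {suc n} (suc w) f
  rewrite all-punchIn w (f ∘ suc) = ∧-left-comm (f zero) (f (suc w)) _

all⇒∀ : (f : Fin n → Bool) → all f ≡ true → ∀ i → f i ≡ true
all⇒∀ f all≡true zero    = ∧-conicalˡ _ _ all≡true
all⇒∀ f all≡true (suc i) = all⇒∀ (f ∘ suc) (∧-conicalʳ _ _ all≡true) i

count≡ᵇn : (f : Fin n → Bool) → (count f ≡ᵇ n) ≡ all f
count≡ᵇn {zero}  f = refl
count≡ᵇn {suc n} f with f zero
... | true  = count≡ᵇn (f ∘ suc)
... | false = dec-false (count (f ∘ suc) ℕ.≟ suc n) (ℕ.<⇒≢ (s≤s (count≤n (f ∘ suc))))

count<n : (f : Fin n → Bool) (z : Fin n) → f z ≡ false → count f < n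
count<n {suc n} f z fz≡false rewrite count-punchIn z f | fz≡false = s≤s (count≤n _)

count+2≤n : (f : Fin n → Bool) {w z : Fin n} → w ≢ z → f w ≡ false → f z ≡ false →
            2 + count f ≤ n
count+2≤n {suc n} f {w} {z} w≢z fw≡false fz≡false rewrite count-punchIn w f | fw≡false =
  s≤s (count<n (f ∘ punchIn w) (punchOut w≢z)
        (trans (cong f (Fin.punchIn-punchOut w≢z)) fz≡false))

module _ {n : ℕ} (p : ParentMap n) where

  ancestor : ℕ → Maybe (Fin n) → Maybe (Fin n)
  ancestor zero    z        = z
  ancestor (suc k) nothing  = nothing
  ancestor (suc k) (just u) = ancestor k (par p u)

  reach⇒ancestor : ∀ k z → reach p k z ≡ true → ancestor k z ≡ nothing
  reach⇒ancestor zero    nothing  _ = refl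
  reach⇒ancestor (suc k) nothing  _ = refl
  reach⇒ancestor (suc k) (just u) r = reach⇒ancestor k (par p u) r

  ancestor⇒reach : ∀ k z → ancestor k z ≡ nothing → reach p k z ≡ true
  ancestor⇒reach zero    nothing  _ = refl
  ancestor⇒reach (suc k) nothing  _ = refl
  ancestor⇒reach (suc k) (just u) a = ancestor⇒reach k (par p u) a

  ancestor-nothing : ∀ k → ancestor k nothing ≡ nothing
  ancestor-nothing zero    = refl
  ancestor-nothing (suc k) = refl

  ancestor-+ : ∀ j k z → ancestor (j + k) z ≡ ancestor k (ancestor j z)
  ancestor-+ zero    k z        = refl
  ancestor-+ (suc j) k nothing  = sym (ancestor-nothing k)
  ancestor-+ (suc j) k (just u) = ancestor-+ j k (par p u)

  ancestor-mono : ∀ {j k} z → j ≤ k → ancestor j z ≡ nothing → ancestor k z ≡ nothing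
  ancestor-mono {j} {k} z j≤k root = begin
    ancestor k z                    ≡⟨ cong (λ i → ancestor i z) (ℕ.m+[n∸m]≡n j≤k) ⟨
    ancestor (j + (k ∸ j)) z        ≡⟨ ancestor-+ j (k ∸ j) z ⟩
    ancestor (k ∸ j) (ancestor j z) ≡⟨ cong (ancestor (k ∸ j)) root ⟩
    ancestor (k ∸ j) nothing        ≡⟨ ancestor-nothing (k ∸ j) ⟩
    nothing                         ∎
    where open ≡-Reasoning

  ancestor-periodic : ∀ {d} z → ancestor d z ≡ z → ∀ c → ancestor (c * d) z ≡ z
  ancestor-periodic     z period zero    = refl
  ancestor-periodic {d} z period (suc c) =
    trans (ancestor-+ d (c * d) z)
          (trans (cong (ancestor (c * d)) period) (ancestor-periodic z period c))

  cycle⇒¬root : ∀ {d b} → 0 < d → ancestor d (just b) ≡ just b →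
                ∀ k → ancestor k (just b) ≢ nothing
  cycle⇒¬root {d} {b} 0<d period k root =
    case trans (sym (ancestor-periodic (just b) period k))
               (ancestor-mono (just b) (ℕ.m≤m*n k d {{>-nonZero 0<d}}) root) of λ ()

  -- Pigeonhole: if the n-th ancestor exists, two of the first n + 1 ancestors coincide, so the
  -- chain is periodic and never reaches a root.
  ancestor-within-n : ∀ k z → ancestor k z ≡ nothing → ancestor n z ≡ nothing
  ancestor-within-n k z root with ancestor n z in nth
  ... | nothing = refl
  ... | just a with Fin.pigeonhole ℕ.≤-refl (λ i → fromMaybe a (ancestor (toℕ i) z))
  ...   | i , j , i<j , same = ⊥-elim (cycle⇒¬root (ℕ.m<n⇒0<n∸m i<j) cycle k rootᵢ)
    where
    open ≡-Reasoning
    defined : ∀ l → l ≤ n → ancestor l z ≡ just (fromMaybe a (ancestor l z))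
    defined l l≤n with ancestor l z in lth
    ... | just _  = refl
    ... | nothing = case trans (sym nth) (ancestor-mono z l≤n lth) of λ ()
    b = fromMaybe a (ancestor (toℕ i) z)
    d = toℕ j ∸ toℕ i
    i≤j = ℕ.<⇒≤ i<j
    ancestorᵢ : ancestor (toℕ i) z ≡ just b
    ancestorᵢ = defined (toℕ i) (Fin.toℕ≤pred[n] i)
    cycle : ancestor d (just b) ≡ just b
    cycle = begin
      ancestor d (just b)                     ≡⟨ cong (ancestor d) ancestorᵢ ⟨
      ancestor d (ancestor (toℕ i) z)         ≡⟨ ancestor-+ (toℕ i) d z ⟨
      ancestor (toℕ i + d) z                  ≡⟨ cong (λ l → ancestor l z) (ℕ.m+[n∸m]≡n i≤j) ⟩
      ancestor (toℕ j) z                      ≡⟨ defined (toℕ j) (Fin.toℕ≤pred[n] j) ⟩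
      just (fromMaybe a (ancestor (toℕ j) z)) ≡⟨ cong just same ⟨
      just b                                  ∎
    rootᵢ : ancestor k (just b) ≡ nothing
    rootᵢ = begin
      ancestor k (just b)                     ≡⟨ cong (ancestor k) ancestorᵢ ⟨
      ancestor k (ancestor (toℕ i) z)         ≡⟨ ancestor-+ (toℕ i) k z ⟨
      ancestor (toℕ i + k) z                  ≡⟨ ancestor-mono z (ℕ.m≤n+m k (toℕ i)) root ⟩
      nothing                                 ∎

  reach-within-n : ∀ k z → reach p k z ≡ true → reach p n z ≡ true
  reach-within-n k z = ancestor⇒reach n z ∘ ancestor-within-n k z ∘ reach⇒ancestor k z

  reach-suc : ∀ k z → reach p k z ≡ true → reach p (suc k) z ≡ true
  reach-suc k       nothing  _ = refl
  reach-suc (suc k) (just u) r = reach-suc k (par p u) r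

  -- Defs checks forests on n vertices with fuel n; this lets the fuel follow a vertex insertion.
  reach-suc-n : ∀ z → reach p (suc n) z ≡ reach p n z
  reach-suc-n z = ⇔→≡ (mk⇔ (reach-within-n (suc n) z) (reach-suc n z))

  ancestorsBelow⇒reach : ∀ k z v → ancestorsBelow p k z v ≡ true → reach p k z ≡ true
  ancestorsBelow⇒reach k       nothing  v _     = refl
  ancestorsBelow⇒reach (suc k) (just u) v below =
    ancestorsBelow⇒reach k (par p u) v (∧-conicalʳ _ _ below)

  ancestorsBelow-suc : ∀ k z v → reach p k z ≡ true →
                       ancestorsBelow p (suc k) z v ≡ ancestorsBelow p k z v
  ancestorsBelow-suc k       nothing  v _ = refl
  ancestorsBelow-suc (suc k) (just u) v r =
    cong ((toℕ u ≤ᵇ toℕ v) ∧_) (ancestorsBelow-suc k (par p u) v r)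

  ancestorsBelow-suc-n : ∀ z v → ancestorsBelow p (suc n) z v ≡ ancestorsBelow p n z v
  ancestorsBelow-suc-n z v = ⇔→≡ (mk⇔
    (λ below → trans (sym (ancestorsBelow-suc n z v
      (reach-within-n (suc n) z (ancestorsBelow⇒reach (suc n) z v below)))) below)
    (λ below → trans (ancestorsBelow-suc n z v (ancestorsBelow⇒reach n z v below)) below))

  ancestorsBelow-top : ∀ k z v → (∀ (u : Fin n) → toℕ u ≤ toℕ v) →
                       ancestorsBelow p k z v ≡ reach p k z
  ancestorsBelow-top k       nothing  v _   = refl
  ancestorsBelow-top zero    (just u) v _   = refl
  ancestorsBelow-top (suc k) (just u) v top
    rewrite dec-true (toℕ u ℕ.≤? toℕ v) (top u) = ancestorsBelow-top k (par p u) v top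

  forest⇒reach : isForest p ≡ true → ∀ z → reach p n z ≡ true
  forest⇒reach forest nothing  = refl
  forest⇒reach forest (just u) =
    reach-within-n (suc n) (just u)
      (all⇒∀ reachesRoot (trans (sym (allB≡all reachesRoot)) forest) u)
    where reachesRoot = λ v → reach p n (par p v)

  forest⇒acyclic : isForest p ≡ true → ∀ {d b} → 0 < d → ancestor d (just b) ≢ just b
  forest⇒acyclic forest 0<d period =
    cycle⇒¬root 0<d period n (reach⇒ancestor n _ (forest⇒reach forest (just _)))

lookup-ext : {A : Set} {u v : Vec A n} → (∀ i → lookup u i ≡ lookup v i) → u ≡ v
lookup-ext {u = u} {v} u≗v =
  trans (sym (tabulate∘lookup u)) (trans (tabulate-cong u≗v) (tabulate∘lookup v))

data PunchView {K : ℕ} (x : Fin (suc K)) : Fin (suc K) → Set where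
  at     : PunchView x x
  beside : ∀ y → PunchView x (punchIn x y)

punchView : ∀ {K} (x z : Fin (suc K)) → PunchView x z
punchView x z with x ≟ z
... | yes refl = at
... | no x≢z   = subst (PunchView x) (Fin.punchIn-punchOut x≢z) (beside (punchOut x≢z))

module _ {K : ℕ} (x : Fin (suc K)) where

  unpunch : Fin (suc K) → Maybe (Fin K)
  unpunch z with x ≟ z
  ... | yes _  = nothing
  ... | no x≢z = just (punchOut x≢z)

  unpunch-self : unpunch x ≡ nothing
  unpunch-self with x ≟ x
  ... | yes _  = refl
  ... | no x≢x = ⊥-elim (x≢x refl)

  unpunch-punchIn : ∀ y → unpunch (punchIn x y) ≡ just y
  unpunch-punchIn y with x ≟ punchIn x y
  ... | yes x≡xʸ = ⊥-elim (Fin.punchInᵢ≢i x y (sym x≡xʸ))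
  ... | no x≢xʸ  = cong just (trans (Fin.punchOut-cong x refl) (Fin.punchOut-punchIn x))

  repunch : Maybe (Fin K) → Fin (suc K)
  repunch nothing  = x
  repunch (just y) = punchIn x y

  repunch-unpunch : ∀ z → repunch (unpunch z) ≡ z
  repunch-unpunch z with punchView x z
  ... | at       = cong repunch unpunch-self
  ... | beside y = cong repunch (unpunch-punchIn y)

  liftParent : Maybe (Fin K) → Maybe (Fin (suc K))
  liftParent = Maybe.map (punchIn x)

  -- A parent equal to x becomes nothing; this only matters when x is not a leaf.
  lowerParent : Maybe (Fin (suc K)) → Maybe (Fin K)
  lowerParent z = z >>= unpunch

  lowerParent-liftParent : ∀ e → lowerParent (liftParent e) ≡ e
  lowerParent-liftParent nothing  = refl
  lowerParent-liftParent (just y) = unpunch-punchIn y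

  liftParent-lowerParent : ∀ z → z ≢ just x → liftParent (lowerParent z) ≡ z
  liftParent-lowerParent nothing  _    = refl
  liftParent-lowerParent (just z) z≢x with punchView x z
  ... | at       = ⊥-elim (z≢x refl)
  ... | beside y = cong liftParent (unpunch-punchIn y)

  liftParent≢just : ∀ e → liftParent e ≢ just x
  liftParent≢just nothing  ()
  liftParent≢just (just y) xʸ≡x = Fin.punchInᵢ≢i x y (Maybe.just-injective xʸ≡x)

  insertLeaf : Maybe (Fin K) → ParentMap K → ParentMap (suc K)
  insertLeaf e p = tabulate (λ z → liftParent (maybe′ (par p) e (unpunch z)))

  deleteLeaf : ParentMap (suc K) → ParentMap K
  deleteLeaf q = tabulate (λ y → lowerParent (par q (punchIn x y)))

  leafParent : ParentMap (suc K) → Maybe (Fin K)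
  leafParent q = lowerParent (par q x)

  module _ (e : Maybe (Fin K)) (p : ParentMap K) where

    par-insertLeaf : ∀ z → par (insertLeaf e p) z ≡ liftParent (maybe′ (par p) e (unpunch z))
    par-insertLeaf = lookup∘tabulate _

    par-insertLeaf-self : par (insertLeaf e p) x ≡ liftParent e
    par-insertLeaf-self =
      trans (par-insertLeaf x) (cong (liftParent ∘ maybe′ (par p) e) unpunch-self)

    par-insertLeaf-punchIn : ∀ y → par (insertLeaf e p) (punchIn x y) ≡ liftParent (par p y)
    par-insertLeaf-punchIn y =
      trans (par-insertLeaf (punchIn x y))
            (cong (liftParent ∘ maybe′ (par p) e) (unpunch-punchIn y))

    insertLeaf-isLeaf : ∀ z → par (insertLeaf e p) z ≢ just x
    insertLeaf-isLeaf z =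
      liftParent≢just (maybe′ (par p) e (unpunch z)) ∘ trans (sym (par-insertLeaf z))

    deleteLeaf-insertLeaf : deleteLeaf (insertLeaf e p) ≡ p
    deleteLeaf-insertLeaf = lookup-ext λ y →
      trans (lookup∘tabulate _ y)
            (trans (cong lowerParent (par-insertLeaf-punchIn y)) (lowerParent-liftParent (par p y)))

    leafParent-insertLeaf : leafParent (insertLeaf e p) ≡ e
    leafParent-insertLeaf = trans (cong lowerParent par-insertLeaf-self) (lowerParent-liftParent e)

  insertLeaf-deleteLeaf : ∀ q → (∀ z → par q z ≢ just x) →
                          insertLeaf (leafParent q) (deleteLeaf q) ≡ q
  insertLeaf-deleteLeaf q isLeaf = lookup-ext λ z → parent z (punchView x z)
    where
    parent : ∀ z → PunchView x z → par (insertLeaf (leafParent q) (deleteLeaf q)) z ≡ par q z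
    parent z at = trans (par-insertLeaf-self (leafParent q) (deleteLeaf q))
                        (liftParent-lowerParent (par q x) (isLeaf x))
    parent z (beside y) = begin
      par (insertLeaf (leafParent q) (deleteLeaf q)) (punchIn x y)
        ≡⟨ par-insertLeaf-punchIn (leafParent q) (deleteLeaf q) y ⟩
      liftParent (par (deleteLeaf q) y)
        ≡⟨ cong liftParent (lookup∘tabulate _ y) ⟩
      liftParent (lowerParent (par q (punchIn x y)))
        ≡⟨ liftParent-lowerParent _ (isLeaf (punchIn x y)) ⟩
      par q (punchIn x y)
        ∎
      where open ≡-Reasoning

≤ᵇ-punchIn : ∀ {K} (x : Fin (suc K)) a b →
             (toℕ (punchIn x a) ≤ᵇ toℕ (punchIn x b)) ≡ (toℕ a ≤ᵇ toℕ b)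
≤ᵇ-punchIn x a b =
  does-⇔ (mk⇔ (Fin.punchIn-cancel-≤ x a b) (Fin.punchIn-mono-≤ x a b)) (_ ℕ.≤? _) (_ ℕ.≤? _)

module _ {K : ℕ} (x : Fin (suc K)) (e : Maybe (Fin K)) (p : ParentMap K) where

  private
    q = insertLeaf x e p

  reach-insertLeaf : ∀ k z → reach q k (liftParent x z) ≡ reach p k z
  reach-insertLeaf k       nothing  = refl
  reach-insertLeaf zero    (just u) = refl
  reach-insertLeaf (suc k) (just u)
    rewrite par-insertLeaf-punchIn x e p u = reach-insertLeaf k (par p u)

  ancestorsBelow-insertLeaf : ∀ k z y →
    ancestorsBelow q k (liftParent x z) (punchIn x y) ≡ ancestorsBelow p k z y
  ancestorsBelow-insertLeaf k       nothing  y = refl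
  ancestorsBelow-insertLeaf zero    (just u) y = refl
  ancestorsBelow-insertLeaf (suc k) (just u) y
    rewrite par-insertLeaf-punchIn x e p u | ≤ᵇ-punchIn x u y =
    cong ((toℕ u ≤ᵇ toℕ y) ∧_) (ancestorsBelow-insertLeaf k (par p u) y)

  isRoot-insertLeaf-self : isRoot q x ≡ is-nothing e
  isRoot-insertLeaf-self = trans (cong is-nothing (par-insertLeaf-self x e p)) (is-nothing-map e)
    where
    is-nothing-map : ∀ e → is-nothing (liftParent x e) ≡ is-nothing e
    is-nothing-map nothing  = refl
    is-nothing-map (just _) = refl

  isRoot-insertLeaf-punchIn : ∀ y → isRoot q (punchIn x y) ≡ isRoot p y
  isRoot-insertLeaf-punchIn y rewrite par-insertLeaf-punchIn x e p y with par p y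
  ... | nothing = refl
  ... | just _  = refl

  isRecord-insertLeaf-punchIn : ∀ y → isRecord q (punchIn x y) ≡ isRecord p y
  isRecord-insertLeaf-punchIn y = begin
    ancestorsBelow q (suc K) (par q (punchIn x y)) (punchIn x y)
      ≡⟨ cong (λ z → ancestorsBelow q (suc K) z (punchIn x y)) (par-insertLeaf-punchIn x e p y) ⟩
    ancestorsBelow q (suc K) (liftParent x (par p y)) (punchIn x y)
      ≡⟨ ancestorsBelow-insertLeaf (suc K) (par p y) y ⟩
    ancestorsBelow p (suc K) (par p y) y
      ≡⟨ ancestorsBelow-suc-n p (par p y) y ⟩
    ancestorsBelow p K (par p y) y
      ∎
    where open ≡-Reasoning

  isForest-insertLeaf : isForest q ≡ isForest p
  isForest-insertLeaf = ⇔→≡ (mk⇔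
    (∧-conicalʳ _ _ ∘ trans (sym unfold))
    (λ forest → trans unfold (cong₂ _∧_ (forest⇒reach p forest e) forest)))
    where
    reachesRoot : Fin (suc K) → Bool
    reachesRoot v = reach q (suc K) (par q v)
    reachesRootᵖ : ∀ z → reach q (suc K) (liftParent x z) ≡ reach p K z
    reachesRootᵖ z = trans (reach-insertLeaf (suc K) z) (reach-suc-n p z)
    unfold : isForest q ≡ reach p K e ∧ isForest p
    unfold = begin
      allB reachesRoot                                      ≡⟨ allB≡all reachesRoot ⟩
      all reachesRoot                                       ≡⟨ all-punchIn x reachesRoot ⟩
      reachesRoot x ∧ all (reachesRoot ∘ punchIn x)
        ≡⟨ cong₂ _∧_ (trans (cong (reach q (suc K)) (par-insertLeaf-self x e p)) (reachesRootᵖ e))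
                     (all-cong λ y → trans (cong (reach q (suc K)) (par-insertLeaf-punchIn x e p y))
                                           (reachesRootᵖ (par p y))) ⟩
      reach p K e ∧ all (λ y → reach p K (par p y))
        ≡⟨ cong (reach p K e ∧_) (allB≡all (λ y → reach p K (par p y))) ⟨
      reach p K e ∧ isForest p                              ∎
      where open ≡-Reasoning

  allRecords-insertLeaf : allRecords q ≡ isRecord q x ∧ allRecords p
  allRecords-insertLeaf = begin
    allB (isRecord q)                           ≡⟨ allB≡all (isRecord q) ⟩
    all (isRecord q)                            ≡⟨ all-punchIn x (isRecord q) ⟩
    isRecord q x ∧ all (isRecord q ∘ punchIn x)
      ≡⟨ cong (isRecord q x ∧_) (all-cong isRecord-insertLeaf-punchIn) ⟩
    isRecord q x ∧ all (isRecord p)             ≡⟨ cong (isRecord q x ∧_) (allB≡all (isRecord p)) ⟨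
    isRecord q x ∧ allRecords p                 ∎
    where open ≡-Reasoning

  numRecords-insertLeaf : numRecords q ≡ indicator (isRecord q x) + numRecords p
  numRecords-insertLeaf = begin
    countB (isRecord q)                                    ≡⟨ countB≡count (isRecord q) ⟩
    count (isRecord q)                                     ≡⟨ count-punchIn x (isRecord q) ⟩
    indicator (isRecord q x) + count (isRecord q ∘ punchIn x)
      ≡⟨ cong (indicator (isRecord q x) +_) (count-cong isRecord-insertLeaf-punchIn) ⟩
    indicator (isRecord q x) + count (isRecord p)
      ≡⟨ cong (indicator (isRecord q x) +_) (countB≡count (isRecord p)) ⟨
    indicator (isRecord q x) + numRecords p
      ∎
    where open ≡-Reasoning

  numTrees-insertLeaf : numTrees q ≡ indicator (is-nothing e) + numTrees p
  numTrees-insertLeaf = begin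
    countB (isRoot q)                                      ≡⟨ countB≡count (isRoot q) ⟩
    count (isRoot q)                                       ≡⟨ count-punchIn x (isRoot q) ⟩
    indicator (isRoot q x) + count (isRoot q ∘ punchIn x)
      ≡⟨ cong₂ _+_ (cong indicator isRoot-insertLeaf-self) (count-cong isRoot-insertLeaf-punchIn) ⟩
    indicator (is-nothing e) + count (isRoot p)
      ≡⟨ cong (indicator (is-nothing e) +_) (countB≡count (isRoot p)) ⟨
    indicator (is-nothing e) + numTrees p
      ∎
    where open ≡-Reasoning

<fromℕ : ∀ {K} {y : Fin (suc K)} → y ≢ fromℕ K → toℕ y < toℕ (fromℕ K)
<fromℕ y≢max = Fin.≤∧≢⇒< (Fin.≤fromℕ _) y≢max

allRecords⇒isRecord : (q : ParentMap n) → allRecords q ≡ true → ∀ v → isRecord q v ≡ true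
allRecords⇒isRecord q records = all⇒∀ (isRecord q) (trans (sym (allB≡all (isRecord q))) records)

ancestorsBelow-above : (q : ParentMap n) {u v : Fin n} → toℕ v < toℕ u →
                       ∀ k → ancestorsBelow q k (just u) v ≡ false
ancestorsBelow-above q         v<u zero    = refl
ancestorsBelow-above q {u} {v} v<u (suc k) rewrite dec-false (toℕ u ℕ.≤? toℕ v) (ℕ.<⇒≱ v<u) = refl

isRecord-below : (q : ParentMap n) {w u : Fin n} → par q w ≡ just u → toℕ w < toℕ u →
                 isRecord q w ≡ false
isRecord-below {n} q parent w<u rewrite parent = ancestorsBelow-above q w<u n

module _ {K : ℕ} where

  private
    max = fromℕ K

  isRecord-insertLeaf-max : ∀ e p → isRecord (insertLeaf max e p) max ≡ reach p K e
  isRecord-insertLeaf-max e p = begin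
    ancestorsBelow q (suc K) (par q max) max
      ≡⟨ cong (λ z → ancestorsBelow q (suc K) z max) (par-insertLeaf-self max e p) ⟩
    ancestorsBelow q (suc K) (liftParent max e) max
      ≡⟨ ancestorsBelow-top q (suc K) (liftParent max e) max Fin.≤fromℕ ⟩
    reach q (suc K) (liftParent max e)
      ≡⟨ reach-insertLeaf max e p (suc K) e ⟩
    reach p (suc K) e
      ≡⟨ reach-suc-n p e ⟩
    reach p K e
      ∎
    where
    open ≡-Reasoning
    q = insertLeaf max e p

  max-isLeaf : (q : ParentMap (suc K)) → isForest q ≡ true → allRecords q ≡ true →
               ∀ y → par q y ≢ just max
  max-isLeaf q forest records y parent with y ≟ max
  ... | yes refl  = forest⇒acyclic q forest {1} (s≤s z≤n) parent
  ... | no  y≢max = case trans (sym (allRecords⇒isRecord q records y))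
                               (isRecord-below q parent (<fromℕ y≢max)) of λ ()

  -- A child z of w would be a second non-record besides w.
  childOfMax-isLeaf : (q : ParentMap (suc K)) → isForest q ≡ true → numRecords q ≡ K →
                        ∀ {w} → par q w ≡ just max → ∀ z → par q z ≢ just w
  childOfMax-isLeaf q forest records {w} parentʷ z parentᶻ =
    ℕ.<-irrefl refl (subst (λ c → 2 + c ≤ suc K) (trans (sym (countB≡count (isRecord q))) records)
                           (count+2≤n (isRecord q) w≢z notRecordʷ notRecordᶻ))
    where
    w≢max : w ≢ max
    w≢max refl = forest⇒acyclic q forest {1} (s≤s z≤n) parentʷ
    z≢max : z ≢ max
    z≢max refl = forest⇒acyclic q forest {2} (s≤s z≤n) (trans (cong (ancestor q 1) parentʷ) parentᶻ)
    w≢z : w ≢ z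
    w≢z refl = w≢max (Maybe.just-injective (trans (sym parentᶻ) parentʷ))
    notRecordʷ : isRecord q w ≡ false
    notRecordʷ = isRecord-below q parentʷ (<fromℕ w≢max)
    notRecordᶻ : isRecord q z ≡ false
    notRecordᶻ = begin
      ancestorsBelow q (suc K) (par q z) z
        ≡⟨ cong (λ u → ancestorsBelow q (suc K) u z) parentᶻ ⟩
      (toℕ w ≤ᵇ toℕ z) ∧ ancestorsBelow q K (par q w) z
        ≡⟨ cong (λ u → (toℕ w ≤ᵇ toℕ z) ∧ ancestorsBelow q K u z) parentʷ ⟩
      (toℕ w ≤ᵇ toℕ z) ∧ ancestorsBelow q K (just max) z
        ≡⟨ cong ((toℕ w ≤ᵇ toℕ z) ∧_) (ancestorsBelow-above q (<fromℕ z≢max) K) ⟩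
      (toℕ w ≤ᵇ toℕ z) ∧ false
        ≡⟨ ∧-zeroʳ _ ⟩
      false
        ∎
      where open ≡-Reasoning

Sub : (A : Set) → (A → Bool) → Set
Sub A P = Σ A (T ∘ P)

Sub-≡ : {A : Set} {P : A → Bool} {a a′ : A} {t : T (P a)} {t′ : T (P a′)} →
        a ≡ a′ → _≡_ {A = Sub A P} (a , t) (a′ , t′)
Sub-≡ refl = cong (_ ,_) (T-irrelevant _ _)

module _ {A : Set} {P : A → Bool} where

  Sub-cong : {Q : A → Bool} → (∀ a → P a ≡ Q a) → Sub A P ↔ Sub A Q
  Sub-cong P≗Q = mk↔ₛ′ (λ (a , t) → a , subst T (P≗Q a) t) (λ (a , t) → a , subst T (sym (P≗Q a)) t)
                       (λ _ → Sub-≡ refl) (λ _ → Sub-≡ refl)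

  Sub-reindex : {B : Set} (f : B → A) (g : A → B) →
                (∀ a → P a ≡ true → f (g a) ≡ a) → (∀ b → P (f b) ≡ true → g (f b) ≡ b) →
                Sub A P ↔ Sub B (P ∘ f)
  Sub-reindex {B} f g fg gf =
    mk↔ₛ′ to from (λ (b , t) → Sub-≡ (gf b (T⇒≡ t))) (λ (a , t) → Sub-≡ (fg a (T⇒≡ t)))
    where
    T⇒≡ : ∀ {b} → T b → b ≡ true
    T⇒≡ = Equivalence.to T-≡
    to : Sub A P → Sub B (P ∘ f)
    to (a , t) = g a , subst (T ∘ P) (sym (fg a (T⇒≡ t))) t
    from : Sub B (P ∘ f) → Sub A P
    from (b , t) = f b , t

  Sub-×ˡ : {B : Set} → Sub (A × B) (P ∘ proj₁) ↔ (Sub A P × B)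
  Sub-×ˡ = mk↔ₛ′ (λ ((a , b) , t) → (a , t) , b) (λ ((a , t) , b) → (a , b) , t)
                 (λ _ → refl) (λ _ → refl)

  Sub-empty : (∀ a → P a ≡ false) → Sub A P ↔ ⊥
  Sub-empty P≗false = mk↔ₛ′ (λ (a , t) → ⊥-elim (subst T (P≗false a) t)) ⊥-elim (λ ())
                            (λ (a , t) → ⊥-elim (subst T (P≗false a) t))

isIncreasing : ℕ → ParentMap n → Bool
isIncreasing m p = isForest p ∧ allRecords p ∧ (numTrees p ≡ᵇ m)

isMarkedIncreasing : ℕ → ParentMap n × Fin n → Bool
isMarkedIncreasing m (p , v) = isIncreasing m p ∧ not (isRoot p v)

isAlmostIncreasing : ℕ → ParentMap n → Bool
isAlmostIncreasing {n} m p = isForest p ∧ (numTrees p ≡ᵇ m) ∧ (numRecords p ≡ᵇ pred n)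

Increasing MarkedIncreasing : ℕ → ℕ → Set
Increasing       m n = Sub (ParentMap n) (isIncreasing m)
MarkedIncreasing m n = Sub (ParentMap n × Fin n) (isMarkedIncreasing m)

𝒩↔MarkedIncreasing : ∀ m n → 𝒩 m n ↔ MarkedIncreasing m n
𝒩↔MarkedIncreasing m n = mk↔ₛ′ to from (λ _ → Sub-≡ refl)
  λ (p , _ , v , _) → cong (p ,_) (cong₂ _,_ (T-irrelevant _ _) (cong (v ,_) (T-irrelevant _ _)))
  where
  to : 𝒩 m n → MarkedIncreasing m n
  to (p , increasing , v , nonRoot) = (p , v) , Equivalence.from T-∧ (increasing , nonRoot)
  from : MarkedIncreasing m n → 𝒩 m n
  from ((p , v) , marked) =
    let increasing , nonRoot = Equivalence.to T-∧ marked in p , increasing , v , nonRoot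

isIncreasing⇒isForest : ∀ m (p : ParentMap n) → isIncreasing m p ≡ true → isForest p ≡ true
isIncreasing⇒isForest m p = ∧-conicalˡ _ _

isIncreasing⇒allRecords : ∀ m (p : ParentMap n) → isIncreasing m p ≡ true → allRecords p ≡ true
isIncreasing⇒allRecords m p = ∧-conicalˡ _ _ ∘ ∧-conicalʳ (isForest p) _

isForest-∧-reach : (p : ParentMap n) (f : Bool → Bool) (e : Maybe (Fin n)) →
               isForest p ∧ f (reach p n e) ≡ isForest p ∧ f true
isForest-∧-reach p f e with isForest p in forest
... | true  rewrite forest⇒reach p forest e = refl
... | false = refl

module _ {K : ℕ} (m : ℕ) (e : Maybe (Fin K)) (p : ParentMap K) where

  private
    q = insertLeaf (fromℕ K) e p
    roots = indicator (is-nothing e) + numTrees p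

  isIncreasing-insertLeaf-max : isIncreasing m q ≡ isForest p ∧ allRecords p ∧ (roots ≡ᵇ m)
  isIncreasing-insertLeaf-max
    rewrite isForest-insertLeaf (fromℕ K) e p | allRecords-insertLeaf (fromℕ K) e p
          | isRecord-insertLeaf-max e p | numTrees-insertLeaf (fromℕ K) e p
    = isForest-∧-reach p (λ r → (r ∧ allRecords p) ∧ (roots ≡ᵇ m)) e

module _ {K : ℕ} (m : ℕ) (e : Maybe (Fin (suc K))) (p : ParentMap (suc K)) where

  private
    q = insertLeaf (fromℕ (suc K)) e p
    roots = indicator (is-nothing e) + numTrees p

  isAlmostIncreasing-insertLeaf-max :
    isAlmostIncreasing m q ≡ isForest p ∧ (roots ≡ᵇ m) ∧ (numRecords p ≡ᵇ K)
  isAlmostIncreasing-insertLeaf-max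
    rewrite isForest-insertLeaf (fromℕ (suc K)) e p | numTrees-insertLeaf (fromℕ (suc K)) e p
          | numRecords-insertLeaf (fromℕ (suc K)) e p | isRecord-insertLeaf-max e p
    = isForest-∧-reach p (λ r → (roots ≡ᵇ m) ∧ (indicator r + numRecords p ≡ᵇ suc K)) e

punchIn-inject₁-fromℕ : (x : Fin (suc n)) → punchIn (inject₁ x) (fromℕ n) ≡ fromℕ (suc n)
punchIn-inject₁-fromℕ         zero    = refl
punchIn-inject₁-fromℕ {suc n} (suc x) = cong suc (punchIn-inject₁-fromℕ x)

pinch-fromℕ-inject₁ : (x : Fin (suc n)) → pinch (fromℕ n) (inject₁ x) ≡ x
pinch-fromℕ-inject₁         zero    = refl
pinch-fromℕ-inject₁ {suc n} (suc x) = cong suc (pinch-fromℕ-inject₁ x)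

inject₁-pinch-fromℕ : (w : Fin (2 + n)) → w ≢ fromℕ (suc n) → inject₁ (pinch (fromℕ n) w) ≡ w
inject₁-pinch-fromℕ         zero       _      = refl
inject₁-pinch-fromℕ {zero}  (suc zero) w≢max = ⊥-elim (w≢max refl)
inject₁-pinch-fromℕ {suc n} (suc w)    w≢max = cong suc (inject₁-pinch-fromℕ w (w≢max ∘ cong suc))

numRecords≡ᵇn : (p : ParentMap n) → (numRecords p ≡ᵇ n) ≡ allRecords p
numRecords≡ᵇn p = begin
  (countB (isRecord p) ≡ᵇ _) ≡⟨ cong (_≡ᵇ _) (countB≡count (isRecord p)) ⟩
  (count (isRecord p) ≡ᵇ _)  ≡⟨ count≡ᵇn (isRecord p) ⟩
  all (isRecord p)           ≡⟨ allB≡all (isRecord p) ⟨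
  allB (isRecord p)          ∎
  where open ≡-Reasoning

module _ {K : ℕ} (x : Fin (suc K)) (p : ParentMap (suc K)) where

  private
    x′ = inject₁ x
    q = insertLeaf x′ (just (fromℕ K)) p

  par-insertLeaf-below-max : par q x′ ≡ just (fromℕ (suc K))
  par-insertLeaf-below-max =
    trans (par-insertLeaf-self x′ (just (fromℕ K)) p) (cong just (punchIn-inject₁-fromℕ x))

  isAlmostIncreasing-insertLeaf-below-max : ∀ m → isAlmostIncreasing m q ≡ isIncreasing m p
  isAlmostIncreasing-insertLeaf-below-max m = begin
    isForest q ∧ (numTrees q ≡ᵇ m) ∧ (numRecords q ≡ᵇ suc K)
      ≡⟨ cong₂ _∧_ (isForest-insertLeaf x′ (just (fromℕ K)) p)
                   (cong₂ (λ t r → (t ≡ᵇ m) ∧ (r ≡ᵇ suc K))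
                          (numTrees-insertLeaf x′ (just (fromℕ K)) p) records) ⟩
    isForest p ∧ (numTrees p ≡ᵇ m) ∧ (numRecords p ≡ᵇ suc K)
      ≡⟨ cong (λ b → isForest p ∧ (numTrees p ≡ᵇ m) ∧ b) (numRecords≡ᵇn p) ⟩
    isForest p ∧ (numTrees p ≡ᵇ m) ∧ allRecords p
      ≡⟨ cong (isForest p ∧_) (∧-comm (numTrees p ≡ᵇ m) (allRecords p)) ⟩
    isForest p ∧ allRecords p ∧ (numTrees p ≡ᵇ m)
      ∎
    where
    open ≡-Reasoning
    records : numRecords q ≡ numRecords p
    records = trans (numRecords-insertLeaf x′ (just (fromℕ K)) p)
                    (cong (λ r → indicator r + numRecords p)
                          (isRecord-below q par-insertLeaf-below-max
                                          (<fromℕ {y = x′} (Fin.fromℕ≢inject₁ ∘ sym))))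

  childOfMax-insertLeaf-below-max : ∀ {m} → isIncreasing m p ≡ true →
                                   ∀ z → par q z ≡ just (fromℕ (suc K)) → z ≡ x′
  childOfMax-insertLeaf-below-max {m} increasing z parentᶻ with punchView x′ z
  ... | at       = refl
  ... | beside y = ⊥-elim (max-isLeaf p (isIncreasing⇒isForest m p increasing)
                                        (isIncreasing⇒allRecords m p increasing) y
                                        (Maybe.map-injective (Fin.punchIn-injective x′ _ _) lifted))
    where
    lifted : liftParent x′ (par p y) ≡ liftParent x′ (just (fromℕ K))
    lifted = trans (sym (par-insertLeaf-punchIn x′ (just (fromℕ K)) p y))
                   (trans parentᶻ (cong just (sym (punchIn-inject₁-fromℕ x))))

OnPred : (ℕ → Set) → ℕ → Set
OnPred X zero    = ⊥
OnPred X (suc m) = X m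

Recurrence : (ℕ → ℕ → Set) → ℕ → ℕ → Set
Recurrence X m K = (X m K × Fin K) ⊎ (OnPred (λ m′ → X m′ K) m ⊎ (Increasing m K × Fin K))

module MarkedIncreasingRecurrence (K : ℕ) where

  private
    top : Fin (2 + K)
    top = fromℕ (suc K)
    Forest = ParentMap (suc K)
    Vertex = Fin (suc K)
    Code = ((Forest × Vertex) × Vertex) ⊎ ((Forest × Vertex) ⊎ (Forest × Vertex))

  decode : Code → ParentMap (2 + K) × Fin (2 + K)
  decode (inj₁ ((p , y) , a))  = insertLeaf top (just a) p , punchIn top y
  decode (inj₂ (inj₁ (p , y))) = insertLeaf top nothing p , punchIn top y
  decode (inj₂ (inj₂ (p , a))) = insertLeaf top (just a) p , top

  encode′ : Forest → Maybe Vertex → Maybe Vertex → Code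
  encode′ p (just a) (just y) = inj₁ ((p , y) , a)
  encode′ p nothing  (just y) = inj₂ (inj₁ (p , y))
  encode′ p (just a) nothing  = inj₂ (inj₂ (p , a))
  -- unreachable: the top vertex would be a marked root
  encode′ p nothing  nothing  = inj₂ (inj₁ (p , zero))

  encode : ParentMap (2 + K) × Fin (2 + K) → Code
  encode (q , v) = encode′ (deleteLeaf top q) (leafParent top q) (unpunch top v)

  decode-encode′ : ∀ m p e w → isMarkedIncreasing m (insertLeaf top e p , repunch top w) ≡ true →
                   decode (encode′ p e w) ≡ (insertLeaf top e p , repunch top w)
  decode-encode′ m p (just a) (just y) _      = refl
  decode-encode′ m p nothing  (just y) _      = refl
  decode-encode′ m p (just a) nothing  _      = refl
  decode-encode′ m p nothing  nothing  marked =
    case trans (cong not (sym (isRoot-insertLeaf-self top nothing p))) (∧-conicalʳ _ _ marked)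
    of λ ()

  decode-encode : ∀ m a → isMarkedIncreasing m a ≡ true → decode (encode a) ≡ a
  decode-encode m (q , v) marked = trans (decode-encode′ m p e w marked′) restore
    where
    p = deleteLeaf top q
    e = leafParent top q
    w = unpunch top v
    increasing = ∧-conicalˡ _ _ marked
    topIsLeaf = max-isLeaf q (isIncreasing⇒isForest m q increasing)
                             (isIncreasing⇒allRecords m q increasing)
    restore : (insertLeaf top e p , repunch top w) ≡ (q , v)
    restore = cong₂ _,_ (insertLeaf-deleteLeaf top q topIsLeaf) (repunch-unpunch top v)
    marked′ = subst (λ a → isMarkedIncreasing m a ≡ true) (sym restore) marked

  encode-decode : ∀ m c → isMarkedIncreasing m (decode c) ≡ true → encode (decode c) ≡ c
  encode-decode m (inj₁ ((p , y) , a)) _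
    rewrite deleteLeaf-insertLeaf top (just a) p | leafParent-insertLeaf top (just a) p
          | unpunch-punchIn top y = refl
  encode-decode m (inj₂ (inj₁ (p , y))) _
    rewrite deleteLeaf-insertLeaf top nothing p | leafParent-insertLeaf top nothing p
          | unpunch-punchIn top y = refl
  encode-decode m (inj₂ (inj₂ (p , a))) _
    rewrite deleteLeaf-insertLeaf top (just a) p | leafParent-insertLeaf top (just a) p
          | unpunch-self top = refl

  isMarkedIncreasing-insertLeaf-max :
    ∀ m p y e → isMarkedIncreasing m (insertLeaf top e p , punchIn top y)
                ≡ (isForest p ∧ allRecords p ∧ (indicator (is-nothing e) + numTrees p ≡ᵇ m))
                  ∧ not (isRoot p y)
  isMarkedIncreasing-insertLeaf-max m p y e =
    cong₂ _∧_ (isIncreasing-insertLeaf-max m e p) (cong not (isRoot-insertLeaf-punchIn top e p y))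

  isMarkedIncreasing-insertLeaf-max-top :
    ∀ m p a → isMarkedIncreasing m (insertLeaf top (just a) p , top) ≡ isIncreasing m p
  isMarkedIncreasing-insertLeaf-max-top m p a =
    trans (cong₂ _∧_ (isIncreasing-insertLeaf-max m (just a) p)
                     (cong not (isRoot-insertLeaf-self top (just a) p)))
          (∧-identityʳ _)

  top-root↔ : ∀ m →
    Sub (Forest × Vertex) (λ (p , y) → isMarkedIncreasing m (insertLeaf top nothing p , punchIn top y))
    ↔ OnPred (λ m′ → MarkedIncreasing m′ (suc K)) m
  top-root↔ zero    = Sub-empty λ (p , y) →
    trans (isMarkedIncreasing-insertLeaf-max 0 p y nothing)
          (cong (_∧ not (isRoot p y))
                (trans (cong (isForest p ∧_) (∧-zeroʳ (allRecords p))) (∧-zeroʳ (isForest p))))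
  top-root↔ (suc m) = Sub-cong λ (p , y) → isMarkedIncreasing-insertLeaf-max (suc m) p y nothing

  recurrence : ∀ m → MarkedIncreasing m (2 + K) ↔ Recurrence MarkedIncreasing m (suc K)
  recurrence m =
    ↔-trans (Sub-reindex decode encode (decode-encode m) (encode-decode m)) (
    ↔-trans Σ-distribʳ-⊎ (
      ↔-trans (Sub-cong λ ((p , y) , a) → isMarkedIncreasing-insertLeaf-max m p y (just a)) Sub-×ˡ
      ⊎-↔
      ↔-trans Σ-distribʳ-⊎ (
        top-root↔ m
        ⊎-↔
        ↔-trans (Sub-cong λ (p , a) → isMarkedIncreasing-insertLeaf-max-top m p a) Sub-×ˡ)))

module AlmostIncreasingRecurrence (K : ℕ) where

  private
    top : Fin (2 + K)
    top = fromℕ (suc K)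
    Forest = ParentMap (suc K)
    Vertex = Fin (suc K)
    Code = (Forest × Vertex) ⊎ (Forest ⊎ (Forest × Vertex))
    ChildOfTop : ParentMap (2 + K) → Set
    ChildOfTop q = ∃ λ w → par q w ≡ just top

  decode : Code → ParentMap (2 + K)
  decode (inj₁ (p , a))        = insertLeaf top (just a) p
  decode (inj₂ (inj₁ p))       = insertLeaf top nothing p
  -- Inserting below the top position shifts the old maximum fromℕ K up to top.
  decode (inj₂ (inj₂ (p , x))) = insertLeaf (inject₁ x) (just (fromℕ K)) p

  encodeLeaf : Forest → Maybe Vertex → Code
  encodeLeaf p (just a) = inj₁ (p , a)
  encodeLeaf p nothing  = inj₂ (inj₁ p)

  childOfTop? : ∀ q → Dec (ChildOfTop q)
  childOfTop? q = Fin.any? λ w → Maybe.≡-dec _≟_ (par q w) (just top)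

  encode′ : ∀ q → Dec (ChildOfTop q) → Code
  encode′ q (yes (w , _)) = inj₂ (inj₂ (deleteLeaf w q , pinch (fromℕ K) w))
  encode′ q (no _)        = encodeLeaf (deleteLeaf top q) (leafParent top q)

  encode : ParentMap (2 + K) → Code
  encode q = encode′ q (childOfTop? q)

  decode-encodeLeaf : ∀ p e → decode (encodeLeaf p e) ≡ insertLeaf top e p
  decode-encodeLeaf p (just a) = refl
  decode-encodeLeaf p nothing  = refl

  decode-encode : ∀ m q → isAlmostIncreasing m q ≡ true → decode (encode q) ≡ q
  decode-encode m q almost with childOfTop? q
  ... | no noChild = trans (decode-encodeLeaf (deleteLeaf top q) (leafParent top q))
                           (insertLeaf-deleteLeaf top q λ z parentᶻ → noChild (z , parentᶻ))
  ... | yes (w , parentʷ) = begin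
    insertLeaf (inject₁ (pinch (fromℕ K) w)) (just (fromℕ K)) (deleteLeaf w q)
      ≡⟨ cong (λ x → insertLeaf x (just (fromℕ K)) (deleteLeaf w q)) w′≡w ⟩
    insertLeaf w (just (fromℕ K)) (deleteLeaf w q)
      ≡⟨ cong (λ e → insertLeaf w e (deleteLeaf w q)) leafParentʷ ⟨
    insertLeaf w (leafParent w q) (deleteLeaf w q)
      ≡⟨ insertLeaf-deleteLeaf w q (childOfMax-isLeaf q forest records parentʷ) ⟩
    q ∎
    where
    open ≡-Reasoning
    forest : isForest q ≡ true
    forest = ∧-conicalˡ _ _ almost
    records : numRecords q ≡ suc K
    records = ℕ.≡ᵇ⇒≡ _ _ (Equivalence.from T-≡ (∧-conicalʳ _ _ (∧-conicalʳ (isForest q) _ almost)))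
    w′≡w : inject₁ (pinch (fromℕ K) w) ≡ w
    w′≡w = inject₁-pinch-fromℕ w λ { refl → forest⇒acyclic q forest {1} (s≤s z≤n) parentʷ }
    punchInʷ : punchIn w (fromℕ K) ≡ top
    punchInʷ = subst (λ x → punchIn x (fromℕ K) ≡ top) w′≡w (punchIn-inject₁-fromℕ _)
    leafParentʷ : leafParent w q ≡ just (fromℕ K)
    leafParentʷ = begin
      lowerParent w (par q w)         ≡⟨ cong (lowerParent w) parentʷ ⟩
      unpunch w top                   ≡⟨ cong (unpunch w) punchInʷ ⟨
      unpunch w (punchIn w (fromℕ K)) ≡⟨ unpunch-punchIn w (fromℕ K) ⟩
      just (fromℕ K)                  ∎

  encode-decode : ∀ m c → isAlmostIncreasing m (decode c) ≡ true → encode (decode c) ≡ c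
  encode-decode m (inj₁ (p , a)) _ with childOfTop? (insertLeaf top (just a) p)
  ... | yes (z , parentᶻ) = ⊥-elim (insertLeaf-isLeaf top (just a) p z parentᶻ)
  ... | no _
    rewrite deleteLeaf-insertLeaf top (just a) p | leafParent-insertLeaf top (just a) p = refl
  encode-decode m (inj₂ (inj₁ p)) _ with childOfTop? (insertLeaf top nothing p)
  ... | yes (z , parentᶻ) = ⊥-elim (insertLeaf-isLeaf top nothing p z parentᶻ)
  ... | no _
    rewrite deleteLeaf-insertLeaf top nothing p | leafParent-insertLeaf top nothing p = refl
  encode-decode m (inj₂ (inj₂ (p , x))) almost
    with childOfTop? (insertLeaf (inject₁ x) (just (fromℕ K)) p)
  ... | no noChild = ⊥-elim (noChild (inject₁ x , par-insertLeaf-below-max x p))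
  ... | yes (w , parentʷ)
    with childOfMax-insertLeaf-below-max x p
           (trans (sym (isAlmostIncreasing-insertLeaf-below-max x p m)) almost) w parentʷ
  ...   | refl = cong (inj₂ ∘ inj₂)
                      (cong₂ _,_ (deleteLeaf-insertLeaf (inject₁ x) (just (fromℕ K)) p)
                                 (pinch-fromℕ-inject₁ x))

  top-root↔ : ∀ m → Sub Forest (λ p → isAlmostIncreasing m (insertLeaf top nothing p))
                  ↔ OnPred (λ m′ → ℛ m′ (suc K)) m
  top-root↔ zero    = Sub-empty λ p →
    trans (isAlmostIncreasing-insertLeaf-max 0 nothing p) (∧-zeroʳ (isForest p))
  top-root↔ (suc m) = Sub-cong (isAlmostIncreasing-insertLeaf-max (suc m) nothing)

  recurrence : ∀ m → ℛ m (2 + K) ↔ Recurrence ℛ m (suc K)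
  recurrence m =
    ↔-trans (Sub-reindex {P = isAlmostIncreasing m} decode encode
                         (decode-encode m) (encode-decode m)) (
    ↔-trans Σ-distribʳ-⊎ (
      ↔-trans (Sub-cong λ (p , a) → isAlmostIncreasing-insertLeaf-max m (just a) p) Sub-×ˡ
      ⊎-↔
      ↔-trans Σ-distribʳ-⊎ (
        top-root↔ m
        ⊎-↔
        ↔-trans (Sub-cong λ (p , x) → isAlmostIncreasing-insertLeaf-below-max x p m) Sub-×ˡ)))

module _ (X Y : ℕ → ℕ → Set) (X-empty : ∀ m → ¬ X m 1) (Y-empty : ∀ m → ¬ Y m 1)
         (X-recurrence : ∀ K m → X m (2 + K) ↔ Recurrence X m (suc K))
         (Y-recurrence : ∀ K m → Y m (2 + K) ↔ Recurrence Y m (suc K)) where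

  ↔-by-recurrence : ∀ K m → X m (suc K) ↔ Y m (suc K)
  ↔-by-recurrence zero    m = mk↔ₛ′ (⊥-elim ∘ X-empty m) (⊥-elim ∘ Y-empty m)
                                    (⊥-elim ∘ Y-empty m) (⊥-elim ∘ X-empty m)
  ↔-by-recurrence (suc K) m =
    ↔-trans (X-recurrence K m)
            (↔-trans ((↔-by-recurrence K m ×-↔ ↔-refl) ⊎-↔ (onPred m ⊎-↔ ↔-refl))
                     (↔-sym (Y-recurrence K m)))
    where
    onPred : ∀ m → OnPred (λ m′ → X m′ (suc K)) m ↔ OnPred (λ m′ → Y m′ (suc K)) m
    onPred zero    = ↔-refl
    onPred (suc m) = ↔-by-recurrence K m

MarkedIncreasing-1-empty : ∀ m → ¬ MarkedIncreasing m 1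
MarkedIncreasing-1-empty m ((nothing ∷ [] , zero) , marked) =
  proj₂ (Equivalence.to (T-∧ {1 ≡ᵇ m}) marked)
MarkedIncreasing-1-empty m ((just zero ∷ [] , zero) , ())

ℛ-1-empty : ∀ m → ¬ ℛ m 1
ℛ-1-empty m (nothing ∷ []   , almost) = proj₂ (Equivalence.to (T-∧ {1 ≡ᵇ m}) almost)
ℛ-1-empty m (just zero ∷ [] , ())

-- The hypotheses matter only for n = 0, where ℛ 0 0 contains the empty forest; for n ≥ 1 the
-- bijection exists for every m.
lemma2p8 : (m n : ℕ) → 1 ≤ m → m ≤ n → 𝒩 m n ⤖ ℛ m n
lemma2p8 (suc m) zero    _ ()
lemma2p8 m       (suc K) _ _ = ↔⇒⤖ (↔-trans (𝒩↔MarkedIncreasing m (suc K)) 𝒩≅ℛ)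
  where
  𝒩≅ℛ : MarkedIncreasing m (suc K) ↔ ℛ m (suc K)
  𝒩≅ℛ = ↔-by-recurrence MarkedIncreasing ℛ MarkedIncreasing-1-empty ℛ-1-empty
          MarkedIncreasingRecurrence.recurrence AlmostIncreasingRecurrence.recurrence K m
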